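{- For any heterogeneous Kleene algebra $\mathbb{H}=(\mathbb{A},\mathbb{s},\otimes_1,\otimes_2,\gamma,e)$, the structure $\mathbb{H}_+$ is a Kleene algebra, and it is a continuous Kleene algebra if $\mathbb{H}$ is continuous. Moreover, the kernel of $\mathbb{H}_+$ is isomorphic to $\mathbb{s}$ as a join-semilattice with bottom (complete join-semilattice in the continuous case).
   Context: A Kleene algebra is a structure $(K, \cup, \cdot, ()^\ast, 1, 0)$ such that: (K1) $(K,\cup,0)$ is a join-semilattice with bottom $0$; (K2) $(K,\cdot,1)$ is a monoid, $\cdot$ preserves $\cup$ in each coordinate, $0$ annihilates $\cdot$; (K3) $1\cup\alpha\cdot\alpha^\ast\leq\alpha^\ast$, $1\cup\alpha^\ast\cdot\alpha\leq\alpha^\ast$, $1\cup\alpha^\ast\cdot\alpha^\ast\leq\alpha^\ast$; (K4) $\alpha\cdot\beta\leq\beta$ implies $\alpha^\ast\cdot\beta\leq\beta$; (K5) $\beta\cdot\alpha\leq\beta$ implies $\beta\cdot\alpha^\ast\leq\beta$. It is continuous if moreover $(K,\cup,0)$ is a complete join-semilattice, $\cdot$ preserves arbitrary joins in each coordinate, and $\alpha^\ast=\bigcup_{n\geq 0}\alpha^n$ ($\alpha^0=1$, $\alpha^{n+1}=\alpha^n\cdot\alpha$). The kernel of a Kleene algebra $\mathbb{K}$ is $(S,\sqcup,0_s)$ with $S=\mathsf{Range}(()^\ast)$, $\xi\sqcup\chi:=(\xi\cup\chi)^\ast$, $0_s:=0^\ast$. A heterogeneous Kleene algebra is a tuple $\mathbb{H}=(\mathbb{A},\mathbb{s},\otimes_1,\otimes_2,\gamma,e)$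 such that: (H1) $\mathbb{A}=(A,\sqcup,\cdot,1,0)$ where $(A,\sqcup,0)$ is a join-semilattice with bottom $0$, $(A,\cdot,1)$ is a monoid, $\cdot$ preserves finite joins in each coordinate and $0$ annihilates $\cdot$; (H2) $\mathbb{s}=(S,\sqcup,0_s)$ is a join-semilattice with bottom $0_s$; (H3) $\otimes_1:S\times A\to A$ preserves finite joins in its second coordinate, is monotone in its first coordinate and has unit $1$ in its second coordinate, and $\otimes_2:A\times S\to A$ preserves finite joins in its first coordinate, is monotone in its second coordinate and has unit $1$ in its first coordinate; moreover $\xi\otimes_1\alpha=e(\xi)\cdot\alpha$ and $\alpha\otimes_2\xi=\alpha\cdot e(\xi)$ for all $\alpha\in A,\xi\in S$; (H4) $\gamma:A\to S$ (surjective) and $e:S\to A$ (injective) satisfy $\gamma\dashv e$ (i.e. $\gamma(\alpha)\leq\xi$ iff $\alpha\leq e(\xi)$) and $\gamma(e(\xi))=\xi$ for all $\xi\in S$; (H5) $1\leq e(\xi)$ and $e(\xi)\cdot e(\xi)\leq e(\xi)$ for all $\xi\in S$; (H6) for all $\alpha,\beta\in A$, $\alpha\cdot\beta\leq\beta$ implies $\gamma(\alpha)\otimes_1\beta\leq\beta$, and $\beta\cdot\alpha\leq\beta$ implies $\beta\otimes_2\gamma(\alpha)\leq\beta$. It is continuous if moreover (H1') $(A,\sqcup,0)$ is complete and $\cdot$ preserves arbitrary joins in each coordinate; (H2') $\mathbb{s}$ is a complete join-semilattice; (H7) $e(\gamma(\alpha))=\bigcup_{n\in\mathbb{N}}\alpha^n$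 for all $\alpha$. For such $\mathbb{H}$, $\mathbb{H}_+:=(A,\sqcup,\cdot,()^\ast,1,0)$ where $\alpha^\ast:=e(\gamma(\alpha))$. -}

module Defs where

open import Level using (Level) renaming (suc to lsuc; _⊔_ to _⊔ℓ_)
open import Data.Nat using (ℕ; zero; suc)
open import Data.Product using (Σ; _×_; _,_; proj₁; ∃)
open import Relation.Binary.PropositionalEquality using (_≡_; refl)

Leq : ∀ {ℓ} {K : Set ℓ} → (K → K → K) → K → K → Set ℓ
Leq _∪_ x y = (x ∪ y) ≡ y

IsLUB : ∀ {ℓ ι} {K : Set ℓ} → (K → K → Set ℓ) → {I : Set ι} → (I → K) → K → Set (ℓ ⊔ℓ ι)
IsLUB {K = K} _≤_ {I} f s = (∀ i → f i ≤ s) × (∀ (u : K) → (∀ i → f i ≤ u) → s ≤ u)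

IsComplete : ∀ {ℓ} {K : Set ℓ} → (K → K → Set ℓ) → Set (lsuc ℓ)
IsComplete {ℓ} {K} _≤_ = ∀ (I : Set ℓ) (f : I → K) → Σ K (IsLUB _≤_ f)

record IsJSL {ℓ} (K : Set ℓ) (_∪_ : K → K → K) (bot : K) : Set ℓ where
  field
    ∪-assoc : ∀ x y z → ((x ∪ y) ∪ z) ≡ (x ∪ (y ∪ z))
    ∪-comm  : ∀ x y → (x ∪ y) ≡ (y ∪ x)
    ∪-idem  : ∀ x → (x ∪ x) ≡ x
    ∪-bot   : ∀ x → (bot ∪ x) ≡ x

pow : ∀ {ℓ} {K : Set ℓ} → (K → K → K) → K → K → ℕ → K
pow _·_ one α zero = one
pow _·_ one α (suc n) = pow _·_ one α n · α

record IsIdempotentSemiring {ℓ} (K : Set ℓ) (_∪_ _·_ : K → K → K) (one zer : K) : Set ℓ where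
  field
    isJSL     : IsJSL K _∪_ zer
    ·-assoc   : ∀ x y z → ((x · y) · z) ≡ (x · (y · z))
    ·-idˡ     : ∀ x → (one · x) ≡ x
    ·-idʳ     : ∀ x → (x · one) ≡ x
    ·-distribˡ : ∀ x y z → (x · (y ∪ z)) ≡ ((x · y) ∪ (x · z))
    ·-distribʳ : ∀ x y z → ((y ∪ z) · x) ≡ ((y · x) ∪ (z · x))
    ·-zeroˡ   : ∀ x → (zer · x) ≡ zer
    ·-zeroʳ   : ∀ x → (x · zer) ≡ zer

record IsKleeneAlgebra {ℓ} (K : Set ℓ) (_∪_ _·_ : K → K → K) (_* : K → K) (one zer : K) : Set ℓ where
  _≤_ = Leq _∪_
  field
    isIdempotentSemiring : IsIdempotentSemiring K _∪_ _·_ one zer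
    K3a : ∀ α → (one ∪ (α · (α *))) ≤ (α *)
    K3b : ∀ α → (one ∪ ((α *) · α)) ≤ (α *)
    K3c : ∀ α → (one ∪ ((α *) · (α *))) ≤ (α *)
    K4  : ∀ α β → (α · β) ≤ β → ((α *) · β) ≤ β
    K5  : ∀ α β → (β · α) ≤ β → (β · (α *)) ≤ β

PreservesJoins : ∀ {ℓ} {K : Set ℓ} → (K → K → K) → (K → K → K) → Set (lsuc ℓ)
PreservesJoins {ℓ} {K} _∪_ _·_ =
  (∀ (I : Set ℓ) (f : I → K) (s : K) → IsLUB (Leq _∪_) f s →
     ∀ a → IsLUB (Leq _∪_) (λ i → a · f i) (a · s))
  × (∀ (I : Set ℓ) (f : I → K) (s : K) → IsLUB (Leq _∪_) f s →
     ∀ a → IsLUB (Leq _∪_) (λ i → f i · a) (s · a))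

record IsContinuousKA {ℓ} (K : Set ℓ) (_∪_ _·_ : K → K → K) (_* : K → K) (one zer : K) : Set (lsuc ℓ) where
  field
    isKleeneAlgebra : IsKleeneAlgebra K _∪_ _·_ _* one zer
    complete        : IsComplete (Leq _∪_)
    ·-preserves     : PreservesJoins _∪_ _·_
    star-sup        : ∀ α → IsLUB (Leq _∪_) (pow _·_ one α) (α *)

record HKA ℓ : Set (lsuc ℓ) where
  infixl 6 _⊔_ _⊔s_
  infixl 7 _·_
  field
    A   : Set ℓ
    _⊔_ : A → A → A
    _·_ : A → A → A
    1a  : A
    0a  : A
    S    : Set ℓ
    _⊔s_ : S → S → S
    0s   : S
    _⊗₁_ : S → A → A
    _⊗₂_ : A → S → A
    γ    : A → S
    e    : S → A
  _≤_  = Leq _⊔_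
  _≤s_ = Leq _⊔s_
  field
    H1 : IsIdempotentSemiring A _⊔_ _·_ 1a 0a
    H2 : IsJSL S _⊔s_ 0s
    ⊗₁-join  : ∀ ξ α β → (ξ ⊗₁ (α ⊔ β)) ≡ ((ξ ⊗₁ α) ⊔ (ξ ⊗₁ β))
    ⊗₁-zero  : ∀ ξ → (ξ ⊗₁ 0a) ≡ 0a
    ⊗₁-mono  : ∀ ξ χ α → ξ ≤s χ → (ξ ⊗₁ α) ≤ (χ ⊗₁ α)
    ⊗₁-unit  : ∀ ξ → (ξ ⊗₁ 1a) ≡ e ξ
    ⊗₂-join  : ∀ α β ξ → ((α ⊔ β) ⊗₂ ξ) ≡ ((α ⊗₂ ξ) ⊔ (β ⊗₂ ξ))
    ⊗₂-zero  : ∀ ξ → (0a ⊗₂ ξ) ≡ 0a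
    ⊗₂-mono  : ∀ α ξ χ → ξ ≤s χ → (α ⊗₂ ξ) ≤ (α ⊗₂ χ)
    ⊗₂-unit  : ∀ ξ → (1a ⊗₂ ξ) ≡ e ξ
    ⊗₁-def   : ∀ ξ α → (ξ ⊗₁ α) ≡ (e ξ · α)
    ⊗₂-def   : ∀ α ξ → (α ⊗₂ ξ) ≡ (α · e ξ)
    γ-surj   : ∀ ξ → ∃ λ α → γ α ≡ ξ
    e-inj    : ∀ ξ χ → e ξ ≡ e χ → ξ ≡ χ
    adj⇒     : ∀ α ξ → γ α ≤s ξ → α ≤ e ξ
    adj⇐     : ∀ α ξ → α ≤ e ξ → γ α ≤s ξ
    γe       : ∀ ξ → γ (e ξ) ≡ ξ
    H5a      : ∀ ξ → 1a ≤ e ξ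
    H5b      : ∀ ξ → (e ξ · e ξ) ≤ e ξ
    H6a      : ∀ α β → (α · β) ≤ β → (γ α ⊗₁ β) ≤ β
    H6b      : ∀ α β → (β · α) ≤ β → (β ⊗₂ γ α) ≤ β

  -- the star of H₊
  _⋆ : A → A
  α ⋆ = e (γ α)

record IsContinuousHKA {ℓ} (H : HKA ℓ) : Set (lsuc ℓ) where
  open HKA H
  field
    A-complete  : IsComplete (Leq _⊔_)
    ·-preserves : PreservesJoins _⊔_ _·_
    S-complete  : IsComplete (Leq _⊔s_)
    H7          : ∀ α → IsLUB (Leq _⊔_) (pow _·_ 1a α) (e (γ α))

module Kernel {ℓ} (K : Set ℓ) (_∪_ : K → K → K) (_* : K → K) (zer : K) where

  Ker : Set ℓ
  Ker = Σ K (λ x → ∃ λ α → (α *) ≡ x)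

  _≈k_ : Ker → Ker → Set ℓ
  x ≈k y = proj₁ x ≡ proj₁ y

  _⊔k_ : Ker → Ker → Ker
  x ⊔k y = (((proj₁ x ∪ proj₁ y) *) , (proj₁ x ∪ proj₁ y) , refl)

  0k : Ker
  0k = ((zer *) , zer , refl)

  _≤k_ : Ker → Ker → Set ℓ
  x ≤k y = (x ⊔k y) ≈k y

  record JSLIso (S : Set ℓ) (_⊔s_ : S → S → S) (0s : S) : Set ℓ where
    field
      to       : Ker → S
      from     : S → Ker
      to-cong  : ∀ x y → x ≈k y → to x ≡ to y
      to-from  : ∀ ξ → to (from ξ) ≡ ξ
      from-to  : ∀ x → from (to x) ≈k x
      to-join  : ∀ x y → to (x ⊔k y) ≡ (to x ⊔s to y)
      to-bot   : to 0k ≡ 0s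

  record CompleteJSLIso (S : Set ℓ) (_⊔s_ : S → S → S) (0s : S) : Set (lsuc ℓ) where
    field
      iso          : JSLIso S _⊔s_ 0s
      Ker-complete : IsComplete _≤k_
      S-complete   : IsComplete (Leq _⊔s_)
    open JSLIso iso
    field
      to-lub   : ∀ (I : Set ℓ) (f : I → Ker) (s : Ker) →
                   IsLUB _≤k_ f s → IsLUB (Leq _⊔s_) (λ i → to (f i)) (to s)
      from-lub : ∀ (I : Set ℓ) (f : I → S) (s : S) →
                   IsLUB (Leq _⊔s_) f s → IsLUB _≤k_ (λ i → from (f i)) (from s)

-- With α ⋆ = e (γ α), the adjunction γ ⊣ e gives α ≤ α ⋆, and γ ∘ e = id makes ⋆
-- idempotent. Unfolding ⊗ᵢ as multiplication by e ξ, the star axioms are then just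
-- (H5) and (H6). The kernel Range(⋆) is the image of e, on which γ and e are mutually
-- inverse and adjoint in both directions; left adjoints preserve joins, bottom and every
-- existing least upper bound, so the kernel is isomorphic to s and inherits completeness.
module Submission where

open import Defs
open import Data.Product using (_×_; _,_; proj₁; proj₂)
open import Function using (_∘_)
open import Relation.Binary.Definitions using (Adjoint; Monotonic₁)
open import Relation.Binary.PropositionalEquality
open ≡-Reasoning

module AdjointLUB {ℓ} {X Y : Set ℓ} (_≤X_ : X → X → Set ℓ) (_≤Y_ : Y → Y → Set ℓ)
         (φ : X → Y) (ψ : Y → X) (φ⊣ψ : Adjoint _≤X_ _≤Y_ φ ψ) (φ-mono : Monotonic₁ _≤X_ _≤Y_ φ) where

  leftAdjoint-preserves-lub : ∀ {ι} (I : Set ι) (f : I → X) (s : X) →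
                              IsLUB _≤X_ f s → IsLUB _≤Y_ (φ ∘ f) (φ s)
  leftAdjoint-preserves-lub _ f s (upper , least) =
    (λ i → φ-mono {f i} {s} (upper i)) ,
    λ u φf≤u → proj₂ (φ⊣ψ {s} {u}) (least (ψ u) (λ i → proj₁ (φ⊣ψ {f i} {u}) (φf≤u i)))

  module _ (ψ⊣φ : Adjoint _≤Y_ _≤X_ ψ φ) where

    lub-from-image : ∀ {ι} {I : Set ι} {f : I → X} {y : Y} →
                     IsLUB _≤Y_ (φ ∘ f) y → IsLUB _≤X_ f (ψ y)
    lub-from-image {f = f} {y} (upper , least) =
      (λ i → proj₁ (φ⊣ψ {f i} {y}) (upper i)) ,
      λ u f≤u → proj₂ (ψ⊣φ {y} {u}) (least (φ u) (λ i → φ-mono {f i} {u} (f≤u i)))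

    complete-from-image : IsComplete _≤Y_ → IsComplete _≤X_
    complete-from-image completeY I f =
      let (y , y-lub) = completeY I (φ ∘ f) in ψ y , lub-from-image y-lub

module JSLOrder {ℓ} {K : Set ℓ} {_∪_ : K → K → K} {⊥ : K} (J : IsJSL K _∪_ ⊥) where
  open IsJSL J

  private
    _≤_ = Leq _∪_

  ≤-refl : ∀ x → x ≤ x
  ≤-refl = ∪-idem

  ≤-trans : ∀ {x y z} → x ≤ y → y ≤ z → x ≤ z
  ≤-trans {x} {y} {z} x≤y y≤z = begin
    x ∪ z         ≡⟨ cong (x ∪_) y≤z ⟨
    x ∪ (y ∪ z)   ≡⟨ ∪-assoc x y z ⟨
    (x ∪ y) ∪ z   ≡⟨ cong (_∪ z) x≤y ⟩
    y ∪ z         ≡⟨ y≤z ⟩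
    z             ∎

  ≤-antisym : ∀ {x y} → x ≤ y → y ≤ x → x ≡ y
  ≤-antisym {x} {y} x≤y y≤x = trans (sym y≤x) (trans (∪-comm y x) x≤y)

  ∪-least : ∀ {x y z} → x ≤ z → y ≤ z → (x ∪ y) ≤ z
  ∪-least {x} {y} {z} x≤z y≤z = trans (∪-assoc x y z) (trans (cong (x ∪_) y≤z) x≤z)

  x≤x∪y : ∀ x y → x ≤ (x ∪ y)
  x≤x∪y x y = trans (sym (∪-assoc x x y)) (cong (_∪ y) (∪-idem x))

  y≤x∪y : ∀ x y → y ≤ (x ∪ y)
  y≤x∪y x y = subst (y ≤_) (∪-comm y x) (x≤x∪y y x)

  ⊥-least : ∀ x → ⊥ ≤ x
  ⊥-least = ∪-bot

module LeftAdjointJSL {a b} {X : Set a} {Y : Set b}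
         {_∪X_ : X → X → X} {⊥X : X} {_∪Y_ : Y → Y → Y} {⊥Y : Y}
         (JX : IsJSL X _∪X_ ⊥X) (JY : IsJSL Y _∪Y_ ⊥Y)
         {φ : X → Y} {ψ : Y → X} (φ⊣ψ : Adjoint (Leq _∪X_) (Leq _∪Y_) φ ψ) where
  private
    module X = JSLOrder JX
    module Y = JSLOrder JY

  unit : ∀ x → Leq _∪X_ x (ψ (φ x))
  unit x = proj₁ φ⊣ψ (Y.≤-refl (φ x))

  mono : Monotonic₁ (Leq _∪X_) (Leq _∪Y_) φ
  mono {x} {x'} x≤x' = proj₂ φ⊣ψ (X.≤-trans x≤x' (unit x'))

  preserves-∪ : ∀ x x' → φ (x ∪X x') ≡ φ x ∪Y φ x'
  preserves-∪ x x' = Y.≤-antisym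
    (proj₂ φ⊣ψ (X.∪-least (proj₁ φ⊣ψ (Y.x≤x∪y (φ x) (φ x'))) (proj₁ φ⊣ψ (Y.y≤x∪y (φ x) (φ x')))))
    (Y.∪-least (mono (X.x≤x∪y x x')) (mono (X.y≤x∪y x x')))

  preserves-⊥ : φ ⊥X ≡ ⊥Y
  preserves-⊥ = Y.≤-antisym (proj₂ φ⊣ψ (X.⊥-least (ψ ⊥Y))) (Y.⊥-least (φ ⊥X))

module IdempotentSemiringOrder {ℓ} {K : Set ℓ} {_∪_ _·_ : K → K → K} {one zer : K}
         (R : IsIdempotentSemiring K _∪_ _·_ one zer) where
  open IsIdempotentSemiring R

  ·-monoʳ : ∀ c {x y} → Leq _∪_ x y → Leq _∪_ (c · x) (c · y)
  ·-monoʳ c {x} {y} x≤y = trans (sym (·-distribˡ c x y)) (cong (c ·_) x≤y)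

  ·-monoˡ : ∀ c {x y} → Leq _∪_ x y → Leq _∪_ (x · c) (y · c)
  ·-monoˡ c {x} {y} x≤y = trans (sym (·-distribʳ c x y)) (cong (_· c) x≤y)

module HKAProperties {ℓ} (H : HKA ℓ) where
  open HKA H
  open IsIdempotentSemiring H1
  open IdempotentSemiringOrder H1
  open JSLOrder isJSL using (≤-trans; ∪-least)

  γ⊣e : Adjoint _≤_ _≤s_ γ e
  γ⊣e {α} {ξ} = adj⇒ α ξ , adj⇐ α ξ

  open LeftAdjointJSL isJSL H2 γ⊣e
    using () renaming (unit to α≤α⋆; preserves-∪ to γ-⊔; preserves-⊥ to γ-0)

  ·⋆≤⋆ : ∀ α → (α · α ⋆) ≤ (α ⋆)
  ·⋆≤⋆ α = ≤-trans (·-monoˡ (α ⋆) (α≤α⋆ α)) (H5b (γ α))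

  ⋆·≤⋆ : ∀ α → (α ⋆ · α) ≤ (α ⋆)
  ⋆·≤⋆ α = ≤-trans (·-monoʳ (α ⋆) (α≤α⋆ α)) (H5b (γ α))

  ⋆-isKleeneAlgebra : IsKleeneAlgebra A _⊔_ _·_ _⋆ 1a 0a
  ⋆-isKleeneAlgebra = record
    { isIdempotentSemiring = H1
    ; K3a = λ α → ∪-least (H5a (γ α)) (·⋆≤⋆ α)
    ; K3b = λ α → ∪-least (H5a (γ α)) (⋆·≤⋆ α)
    ; K3c = λ α → ∪-least (H5a (γ α)) (H5b (γ α))
    ; K4  = λ α β αβ≤β → subst (_≤ β) (⊗₁-def (γ α) β) (H6a α β αβ≤β)
    ; K5  = λ α β βα≤β → subst (_≤ β) (⊗₂-def β (γ α)) (H6b α β βα≤β)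
    }

  ⋆-isContinuousKA : IsContinuousHKA H → IsContinuousKA A _⊔_ _·_ _⋆ 1a 0a
  ⋆-isContinuousKA c = record
    { isKleeneAlgebra = ⋆-isKleeneAlgebra
    ; complete        = A-complete
    ; ·-preserves     = ·-preserves
    ; star-sup        = H7
    }
    where open IsContinuousHKA c

  ⋆-idempotent : ∀ α → (α ⋆) ⋆ ≡ α ⋆
  ⋆-idempotent α = cong e (γe (γ α))

  open Kernel A _⊔_ _⋆ 0a

  toS : Ker → S
  toS = γ ∘ proj₁

  fromS : S → Ker
  fromS ξ = e ξ , e ξ , cong e (γe ξ)

  kernel-⋆-fixed : ∀ (x : Ker) → proj₁ x ⋆ ≡ proj₁ x
  kernel-⋆-fixed (_ , α , refl) = ⋆-idempotent α

  ≤k⇒≤s : ∀ {x y} → x ≤k y → toS x ≤s toS y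
  ≤k⇒≤s {x} {y} x≤y = begin
    toS x ⊔s toS y        ≡⟨ γ-⊔ (proj₁ x) (proj₁ y) ⟨
    γ (proj₁ x ⊔ proj₁ y) ≡⟨ γe _ ⟨
    γ (proj₁ (x ⊔k y))    ≡⟨ cong γ x≤y ⟩
    toS y                 ∎

  ≤s⇒≤k : ∀ {x y} → toS x ≤s toS y → x ≤k y
  ≤s⇒≤k {x} {y} x≤y = begin
    e (γ (proj₁ x ⊔ proj₁ y)) ≡⟨ cong e (γ-⊔ (proj₁ x) (proj₁ y)) ⟩
    e (toS x ⊔s toS y)        ≡⟨ cong e x≤y ⟩
    proj₁ y ⋆                 ≡⟨ kernel-⋆-fixed y ⟩
    proj₁ y                   ∎

  toS⊣fromS : Adjoint _≤k_ _≤s_ toS fromS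
  toS⊣fromS {x} {ξ} =
    (λ x≤ξ → ≤s⇒≤k {x} {fromS ξ} (subst (toS x ≤s_) (sym (γe ξ)) x≤ξ)) ,
    (λ x≤ξ → subst (toS x ≤s_) (γe ξ) (≤k⇒≤s {x} {fromS ξ} x≤ξ))

  fromS⊣toS : Adjoint _≤s_ _≤k_ fromS toS
  fromS⊣toS {ξ} {x} =
    (λ ξ≤x → subst (_≤s toS x) (γe ξ) (≤k⇒≤s {fromS ξ} {x} ξ≤x)) ,
    (λ ξ≤x → ≤s⇒≤k {fromS ξ} {x} (subst (_≤s toS x) (sym (γe ξ)) ξ≤x))

  fromS-mono : Monotonic₁ _≤s_ _≤k_ fromS
  fromS-mono {ξ} {χ} ξ≤χ = ≤s⇒≤k {fromS ξ} {fromS χ} (subst₂ _≤s_ (sym (γe ξ)) (sym (γe χ)) ξ≤χ)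

  kernel≅s : JSLIso S _⊔s_ 0s
  kernel≅s = record
    { to      = toS
    ; from    = fromS
    ; to-cong = λ _ _ → cong γ
    ; to-from = γe
    ; from-to = kernel-⋆-fixed
    ; to-join = λ x y → trans (γe _) (γ-⊔ (proj₁ x) (proj₁ y))
    ; to-bot  = trans (γe (γ 0a)) γ-0
    }

  kernel≅s-complete : IsContinuousHKA H → CompleteJSLIso S _⊔s_ 0s
  kernel≅s-complete c = record
    { iso          = kernel≅s
    ; Ker-complete = ToS.complete-from-image (λ {ξ} {x} → fromS⊣toS {ξ} {x}) S-complete
    ; S-complete   = S-complete
    ; to-lub       = ToS.leftAdjoint-preserves-lub
    ; from-lub     = FromS.leftAdjoint-preserves-lub
    }
    where
    open IsContinuousHKA c
    -- ≤k ignores the range witness of a kernel element, so implicit Ker arguments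
    -- cannot be inferred by unification and are supplied by η-expansion.
    module ToS = AdjointLUB _≤k_ _≤s_ toS fromS
      (λ {x} {ξ} → toS⊣fromS {x} {ξ}) (λ {x} {y} → ≤k⇒≤s {x} {y})
    module FromS = AdjointLUB _≤s_ _≤k_ fromS toS (λ {ξ} {x} → fromS⊣toS {ξ} {x}) fromS-mono

proposition3p11 : ∀ {ℓ} (H : HKA ℓ) →
    IsKleeneAlgebra (HKA.A H) (HKA._⊔_ H) (HKA._·_ H) (HKA._⋆ H) (HKA.1a H) (HKA.0a H)
    × (IsContinuousHKA H →
        IsContinuousKA (HKA.A H) (HKA._⊔_ H) (HKA._·_ H) (HKA._⋆ H) (HKA.1a H) (HKA.0a H))
    × Kernel.JSLIso (HKA.A H) (HKA._⊔_ H) (HKA._⋆ H) (HKA.0a H) (HKA.S H) (HKA._⊔s_ H) (HKA.0s H)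
    × (IsContinuousHKA H →
        Kernel.CompleteJSLIso (HKA.A H) (HKA._⊔_ H) (HKA._⋆ H) (HKA.0a H) (HKA.S H) (HKA._⊔s_ H) (HKA.0s H))
proposition3p11 H = ⋆-isKleeneAlgebra , ⋆-isContinuousKA , kernel≅s , kernel≅s-complete
  where open HKAProperties H
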